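{- Let $S$ be a set of transpositions generating $S_n$, and let $\tau, \kappa \in S$ with $\tau \ne \kappa$. Then $\tau\kappa = \kappa\tau$ if and only if there is a unique 4-cycle in $\mathrm{Cay}(S_n,S)$ containing the vertices $e$, $\tau$ and $\kappa$.
   Context: For a group $H$ and a subset $S \subseteq H$ with $1 \notin S$ and $S = S^{ -1}$, the Cayley graph $\mathrm{Cay}(H,S)$ is the simple undirected graph with vertex set $H$ and edges $\{h, sh\}$ for $h \in H$, $s \in S$. Here $e$ is the identity element of $S_n$. -}

module Defs where

open import Data.Nat using (ℕ)
open import Data.Fin using (Fin)
open import Data.Fin.Permutation using (Permutation′; _≈_; _∘ₚ_; id; transpose)
open import Data.List using (List; []; _∷_)
open import Data.List.Relation.Unary.Any using (Any)
open import Data.Product using (Σ; ∃; _×_; _,_)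
open import Data.Sum using (_⊎_)
open import Relation.Binary.PropositionalEquality using (_≡_)
open import Relation.Nullary using (¬_)
open import Function.Bundles using (_⇔_)

Sym : ℕ → Set
Sym n = Permutation′ n

-- Group product in S_n, as composition of functions:
-- (σ · π)(i) = σ (π i)   (so σ · π means "first π, then σ").
infixl 7 _·_
_·_ : {n : ℕ} → Sym n → Sym n → Sym n
σ · π = π ∘ₚ σ

e : {n : ℕ} → Sym n
e = id

_∈S_ : {n : ℕ} → Sym n → List (Sym n) → Set
σ ∈S S = Any (λ s → σ ≈ s) S

IsTransposition : {n : ℕ} → Sym n → Set
IsTransposition {n} σ = Σ (Fin n) λ i → Σ (Fin n) λ j → ¬ (i ≡ j) × (σ ≈ transpose i j)

prod : {n : ℕ} → List (Sym n) → Sym n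
prod [] = e
prod (s ∷ ss) = s · prod ss

-- S generates S_n: every permutation is a product of elements of S.
-- (Since transpositions are involutions, inverses are not needed.)
Generates : {n : ℕ} → List (Sym n) → Set
Generates {n} S = (π : Sym n) → Σ (List (Sym n)) λ ws →
  Data.List.Relation.Unary.All.All (λ w → w ∈S S) ws × (prod ws ≈ π)
  where import Data.List.Relation.Unary.All

Adj : {n : ℕ} → List (Sym n) → Sym n → Sym n → Set
Adj {n} S g h = Σ (Sym n) λ s → (s ∈S S) × (h ≈ s · g)

record Cycle4 {n : ℕ} (S : List (Sym n)) : Set where
  field
    v₀ v₁ v₂ v₃ : Sym n
    d₀₁ : ¬ (v₀ ≈ v₁)
    d₀₂ : ¬ (v₀ ≈ v₂)
    d₀₃ : ¬ (v₀ ≈ v₃)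
    d₁₂ : ¬ (v₁ ≈ v₂)
    d₁₃ : ¬ (v₁ ≈ v₃)
    d₂₃ : ¬ (v₂ ≈ v₃)
    a₀₁ : Adj S v₀ v₁
    a₁₂ : Adj S v₁ v₂
    a₂₃ : Adj S v₂ v₃
    a₃₀ : Adj S v₃ v₀

open Cycle4 public

IsEdgeOf : {n : ℕ} {S : List (Sym n)} → Cycle4 S → Sym n → Sym n → Set
IsEdgeOf C u v =
    UEdge (v₀ C) (v₁ C) ⊎ (UEdge (v₁ C) (v₂ C) ⊎ (UEdge (v₂ C) (v₃ C) ⊎ UEdge (v₃ C) (v₀ C)))
  where
    UEdge : _ → _ → Set
    UEdge a b = ((u ≈ a) × (v ≈ b)) ⊎ ((u ≈ b) × (v ≈ a))

SameCycle : {n : ℕ} {S : List (Sym n)} → Cycle4 S → Cycle4 S → Set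
SameCycle {n} C D = (u v : Sym n) → IsEdgeOf C u v ⇔ IsEdgeOf D u v

OnCycle : {n : ℕ} {S : List (Sym n)} → Sym n → Cycle4 S → Set
OnCycle x C = (x ≈ v₀ C) ⊎ ((x ≈ v₁ C) ⊎ ((x ≈ v₂ C) ⊎ (x ≈ v₃ C)))

Contains3 : {n : ℕ} {S : List (Sym n)} → Cycle4 S → Sym n → Sym n → Sym n → Set
Contains3 C a b c = OnCycle a C × (OnCycle b C × OnCycle c C)

UniqueCycle4Through : {n : ℕ} → (S : List (Sym n)) → Sym n → Sym n → Sym n → Set
UniqueCycle4Through S a b c =
  Σ (Cycle4 S) λ C → Contains3 C a b c × ((D : Cycle4 S) → Contains3 D a b c → SameCycle C D)

-- Every edge of Cay(S_n, S) is labelled by a transposition, and a product of two transpositions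
-- is never a transposition, so the graph has no triangles. Hence, up to rotation and reflection,
-- a 4-cycle through e, τ, κ is e – τ – w – κ with w = ατ = βκ for some α, β ∈ S, and solving
-- this equation gives α = κ or β = τ, i.e. w = κτ or w = τκ. If τ and κ commute, w = κτ is
-- forced and e – τ – κτ – κ is the only such cycle. Otherwise they share a point, so
-- τκτ = κτκ; any such cycle puts this transposition into S, and then κτ ≠ τκ give two cycles.
module Submission where

open import Defs
open import Data.Nat using (ℕ; zero; suc)
open import Data.Fin using (Fin)
open import Data.Fin.Properties using (_≟_)
open import Data.Fin.Permutation
  using (_≈_; _⟨$⟩ʳ_; _⟨$⟩ˡ_; inverseˡ; inverseʳ; transpose)
open import Data.List using (List; _∷_)
open import Data.List.Relation.Unary.All using (All; _∷_)
open import Data.List.Relation.Unary.Any as Any using (here; there)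
open import Data.Product using (Σ-syntax; _×_; _,_; proj₁)
open import Data.Sum as Sum using (_⊎_; inj₁; inj₂; swap)
open import Data.Empty using (⊥-elim)
open import Function using (_∘_; id)
open import Function.Bundles using (_⇔_; mk⇔; Equivalence)
open import Function.Construct.Composition using (_⇔-∘_)
open import Function.Construct.Symmetry using (⇔-sym)
open import Relation.Binary.Bundles using (Setoid)
import Relation.Binary.Reasoning.Setoid
open import Relation.Binary.PropositionalEquality
  using (_≡_; _≢_; refl; sym; trans; cong; module ≡-Reasoning)
open import Relation.Nullary using (¬_; yes; no)
open import Relation.Nullary.Decidable using (dec-true; dec-false; toSum; decidable-stable)

-- The pointwise equality _≈_ of permutations unfolds to a Π-type, so Agda cannot infer the
-- permutations it relates; _≃_ is the same relation wrapped in a record, which it can.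
infix 4 _≃_
record _≃_ {n : ℕ} (σ π : Sym n) : Set where
  constructor ≈⇒≃
  field ≃⇒≈ : σ ≈ π

open _≃_ public

module _ {n : ℕ} where

  ≃-refl : {σ : Sym n} → σ ≃ σ
  ≃-refl = ≈⇒≃ λ _ → refl

  ≃-sym : {σ π : Sym n} → σ ≃ π → π ≃ σ
  ≃-sym (≈⇒≃ σ≈π) = ≈⇒≃ λ k → sym (σ≈π k)

  ≃-trans : {σ π ρ : Sym n} → σ ≃ π → π ≃ ρ → σ ≃ ρ
  ≃-trans (≈⇒≃ σ≈π) (≈⇒≃ π≈ρ) = ≈⇒≃ λ k → trans (σ≈π k) (π≈ρ k)

  ≃-setoid : Setoid _ _
  ≃-setoid = record
    { Carrier = Sym n
    ; _≈_ = _≃_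
    ; isEquivalence = record { refl = ≃-refl ; sym = ≃-sym ; trans = ≃-trans }
    }

  ≄⇒≉ : {σ π : Sym n} → ¬ σ ≃ π → ¬ σ ≈ π
  ≄⇒≉ σ≄π = σ≄π ∘ ≈⇒≃

  ≉-sym : (σ π : Sym n) → ¬ σ ≈ π → ¬ π ≈ σ
  ≉-sym _ _ σ≉π π≈σ = σ≉π λ k → sym (π≈σ k)

  ·-congˡ : (σ : Sym n) {π ρ : Sym n} → π ≃ ρ → σ · π ≃ σ · ρ
  ·-congˡ σ (≈⇒≃ π≈ρ) = ≈⇒≃ λ k → cong (σ ⟨$⟩ʳ_) (π≈ρ k)

  ·-congʳ : (π : Sym n) {σ ρ : Sym n} → σ ≃ ρ → σ · π ≃ ρ · π
  ·-congʳ π (≈⇒≃ σ≈ρ) = ≈⇒≃ λ k → σ≈ρ (π ⟨$⟩ʳ k)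

  ⟨$⟩ʳ-injective : (π : Sym n) {x y : Fin n} → π ⟨$⟩ʳ x ≡ π ⟨$⟩ʳ y → x ≡ y
  ⟨$⟩ʳ-injective π eq = trans (sym (inverseˡ π)) (trans (cong (π ⟨$⟩ˡ_) eq) (inverseˡ π))

module ≃-Reasoning {n : ℕ} = Relation.Binary.Reasoning.Setoid (≃-setoid {n})

-- IsTransposition σ unfolds to _≈_ as well; Transposition σ is its record counterpart.
record Transposition {n : ℕ} (σ : Sym n) : Set where
  constructor transposition
  field
    i j : Fin n
    i≢j : i ≢ j
    σ≃ij : σ ≃ transpose i j

module _ {n : ℕ} where

  transpose-applyˡ : (i j : Fin n) → transpose i j ⟨$⟩ʳ i ≡ j
  transpose-applyˡ i j rewrite dec-true (i ≟ i) refl = refl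

  transpose-applyʳ : (i j : Fin n) → transpose i j ⟨$⟩ʳ j ≡ i
  transpose-applyʳ i j with j ≟ i
  ... | yes j≡i = j≡i
  ... | no _ rewrite dec-true (j ≟ j) refl = refl

  transpose-apply-other : {i j k : Fin n} → k ≢ i → k ≢ j → transpose i j ⟨$⟩ʳ k ≡ k
  transpose-apply-other {i} {j} {k} k≢i k≢j
    rewrite dec-false (k ≟ i) k≢i | dec-false (k ≟ j) k≢j = refl

  transpose-cong : {i i′ j j′ : Fin n} → i ≡ i′ → j ≡ j′ → transpose i j ≃ transpose i′ j′
  transpose-cong refl refl = ≃-refl

  transpose-comm : (i j : Fin n) → transpose i j ≃ transpose j i
  transpose-comm i j = ≈⇒≃ swapped
    where
      swapped : transpose i j ≈ transpose j i
      swapped k with toSum (k ≟ i) | toSum (k ≟ j)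
      ... | inj₁ refl | _ = trans (transpose-applyˡ k j) (sym (transpose-applyʳ j k))
      ... | inj₂ _ | inj₁ refl = trans (transpose-applyʳ i k) (sym (transpose-applyˡ k i))
      ... | inj₂ k≢i | inj₂ k≢j =
        trans (transpose-apply-other k≢i k≢j) (sym (transpose-apply-other k≢j k≢i))

  transpose-conjugate : (π : Sym n) (i j : Fin n) →
    π · transpose i j ≃ transpose (π ⟨$⟩ʳ i) (π ⟨$⟩ʳ j) · π
  transpose-conjugate π i j = ≈⇒≃ relabelled
    where
      πi = π ⟨$⟩ʳ i
      πj = π ⟨$⟩ʳ j
      relabelled : π · transpose i j ≈ transpose πi πj · π
      relabelled k with toSum (k ≟ i) | toSum (k ≟ j)
      ... | inj₁ refl | _ =
        trans (cong (π ⟨$⟩ʳ_) (transpose-applyˡ k j)) (sym (transpose-applyˡ πi πj))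
      ... | inj₂ _ | inj₁ refl =
        trans (cong (π ⟨$⟩ʳ_) (transpose-applyʳ i k)) (sym (transpose-applyʳ πi πj))
      ... | inj₂ k≢i | inj₂ k≢j =
        trans (cong (π ⟨$⟩ʳ_) (transpose-apply-other k≢i k≢j))
              (sym (transpose-apply-other (k≢i ∘ ⟨$⟩ʳ-injective π) (k≢j ∘ ⟨$⟩ʳ-injective π)))

  transposition-involutive : {σ : Sym n} → Transposition σ → σ · σ ≃ e
  transposition-involutive {σ} (transposition i j _ σ≃ij) = begin
    σ · σ                          ≈⟨ ·-congˡ σ σ≃ij ⟩
    σ · transpose i j              ≈⟨ ·-congʳ (transpose i j) σ≃ij ⟩
    transpose i j · transpose i j  ≈⟨ ·-congˡ (transpose i j) (transpose-comm i j) ⟩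
    transpose i j · transpose j i  ≈⟨ ≈⇒≃ (λ _ → inverseʳ (transpose i j)) ⟩
    e                              ∎
    where open ≃-Reasoning

  transposition-≄e : {σ : Sym n} → Transposition σ → ¬ σ ≃ e
  transposition-≄e (transposition i j i≢j σ≃ij) σ≃e =
    i≢j (trans (sym (≃⇒≈ σ≃e i)) (trans (≃⇒≈ σ≃ij i) (transpose-applyˡ i j)))

  ·-cancelʳ : {σ π ρ : Sym n} → Transposition σ → π · σ ≃ ρ · σ → π ≃ ρ
  ·-cancelʳ {σ} {π} {ρ} tσ πσ≃ρσ = begin
    π            ≡⟨⟩
    π · e        ≈⟨ ·-congˡ π (transposition-involutive tσ) ⟨
    π · σ · σ    ≈⟨ ·-congʳ σ πσ≃ρσ ⟩
    ρ · σ · σ    ≈⟨ ·-congˡ ρ (transposition-involutive tσ) ⟩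
    ρ            ∎
    where open ≃-Reasoning

  IsTransposition⇒Transposition : {σ : Sym n} → IsTransposition σ → Transposition σ
  IsTransposition⇒Transposition (i , j , i≢j , σ≈ij) = transposition i j i≢j (≈⇒≃ σ≈ij)

  transposition-resp : {σ π : Sym n} → Transposition σ → σ ≃ π → Transposition π
  transposition-resp (transposition i j i≢j σ≃ij) σ≃π =
    transposition i j i≢j (≃-trans (≃-sym σ≃π) σ≃ij)

  ·-cancelˡ : {σ π ρ : Sym n} → Transposition σ → σ · π ≃ σ · ρ → π ≃ ρ
  ·-cancelˡ {σ} {π} {ρ} tσ σπ≃σρ = begin
    π            ≡⟨⟩
    e · π        ≈⟨ ·-congʳ π (transposition-involutive tσ) ⟨
    σ · σ · π    ≈⟨ ·-congˡ σ σπ≃σρ ⟩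
    σ · σ · ρ    ≈⟨ ·-congʳ ρ (transposition-involutive tσ) ⟩
    ρ            ∎
    where open ≃-Reasoning

  transposition-conjugate : {π : Sym n} → Transposition π → (i j : Fin n) →
    π · transpose i j · π ≃ transpose (π ⟨$⟩ʳ i) (π ⟨$⟩ʳ j)
  transposition-conjugate {π} tπ i j = begin
    π · transpose i j · π                        ≈⟨ ·-congʳ π (transpose-conjugate π i j) ⟩
    transpose (π ⟨$⟩ʳ i) (π ⟨$⟩ʳ j) · (π · π)  ≈⟨ ·-congˡ _ (transposition-involutive tπ) ⟩
    transpose (π ⟨$⟩ʳ i) (π ⟨$⟩ʳ j)            ∎
    where open ≃-Reasoning

  transposition-determined : {σ : Sym n} → Transposition σ → {u v : Fin n} →
    σ ⟨$⟩ʳ u ≡ v → u ≢ v → σ ≃ transpose u v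
  transposition-determined (transposition i j _ σ≃ij) {u} σu≡v u≢v
    with toSum (u ≟ i) | toSum (u ≟ j)
  ... | inj₁ refl | _
    with refl ← trans (sym (transpose-applyˡ u j)) (trans (sym (≃⇒≈ σ≃ij u)) σu≡v) = σ≃ij
  ... | inj₂ _ | inj₁ refl
    with refl ← trans (sym (transpose-applyʳ i u)) (trans (sym (≃⇒≈ σ≃ij u)) σu≡v) =
    ≃-trans σ≃ij (transpose-comm i u)
  ... | inj₂ u≢i | inj₂ u≢j =
    ⊥-elim (u≢v (trans (sym (transpose-apply-other u≢i u≢j)) (trans (sym (≃⇒≈ σ≃ij u)) σu≡v)))

  data FixesEndpoint (κ τ : Sym n) : Set where
    fixesEndpoint : (a b : Fin n) → a ≢ b → τ ≃ transpose a b → κ ⟨$⟩ʳ b ≡ b →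
      FixesEndpoint κ τ

  -- A transposition that moves both points of τ is τ itself.
  ≃-or-fixesEndpoint : {τ κ : Sym n} → Transposition τ → Transposition κ →
    κ ≃ τ ⊎ FixesEndpoint κ τ
  ≃-or-fixesEndpoint {τ} {κ} (transposition a b a≢b τ≃ab) tκ
    with toSum (κ ⟨$⟩ʳ b ≟ b) | toSum (κ ⟨$⟩ʳ a ≟ a)
  ... | inj₁ κb≡b | _ = inj₂ (fixesEndpoint a b a≢b τ≃ab κb≡b)
  ... | inj₂ _ | inj₁ κa≡a =
    inj₂ (fixesEndpoint b a (a≢b ∘ sym) (≃-trans τ≃ab (transpose-comm a b)) κa≡a)
  ... | inj₂ κb≢b | inj₂ κa≢a =
    inj₁ (≃-trans κ≃a[κa] (≃-trans (transpose-cong refl (sym b≡κa)) (≃-sym τ≃ab)))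
    where
      κ≃a[κa] : κ ≃ transpose a (κ ⟨$⟩ʳ a)
      κ≃a[κa] = transposition-determined tκ refl (κa≢a ∘ sym)
      b≡κa : b ≡ κ ⟨$⟩ʳ a
      b≡κa = decidable-stable (b ≟ κ ⟨$⟩ʳ a) λ b≢κa →
        κb≢b (trans (≃⇒≈ κ≃a[κa] b) (transpose-apply-other (a≢b ∘ sym) b≢κa))

  -- Cayley graphs generated by transpositions have no triangles.
  transposition-product-not-transposition : {σ π : Sym n} →
    Transposition σ → Transposition π → ¬ Transposition (σ · π)
  transposition-product-not-transposition {σ} {π} tσ tπ tσπ with ≃-or-fixesEndpoint tπ tσ
  ... | inj₁ σ≃π =
    transposition-≄e tσπ (≃-trans (·-congʳ π σ≃π) (transposition-involutive tπ))
  ... | inj₂ (fixesEndpoint a b a≢b π≃ab σb≡b) = transposition-≄e tσ (·-cancelʳ tπ σπ≃π)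
    where
      σπa≡b : (σ · π) ⟨$⟩ʳ a ≡ b
      σπa≡b = trans (cong (σ ⟨$⟩ʳ_) (trans (≃⇒≈ π≃ab a) (transpose-applyˡ a b))) σb≡b
      σπ≃π : σ · π ≃ e · π
      σπ≃π = ≃-trans (transposition-determined tσπ σπa≡b a≢b) (≃-sym π≃ab)

  commute-or-braid : {τ κ : Sym n} → Transposition τ → Transposition κ →
    τ · κ ≃ κ · τ ⊎ τ · κ · τ ≃ κ · τ · κ
  commute-or-braid {τ} {κ} tτ tκ with ≃-or-fixesEndpoint tτ tκ
  ... | inj₁ κ≃τ = inj₁ (≃-trans (·-congˡ τ κ≃τ) (·-congʳ τ (≃-sym κ≃τ)))
  ... | inj₂ (fixesEndpoint a b a≢b τ≃ab κb≡b) =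
    Sum.[ inj₁ ∘ κ-fixes-a⇒commute , inj₂ ∘ κ-moves-a⇒braid ] (toSum (κ ⟨$⟩ʳ a ≟ a))
    where
      open ≃-Reasoning

      κ-fixes-a⇒commute : κ ⟨$⟩ʳ a ≡ a → τ · κ ≃ κ · τ
      κ-fixes-a⇒commute κa≡a = begin
        τ · κ                                  ≈⟨ ·-congʳ κ τ≃ab ⟩
        transpose a b · κ                      ≈⟨ ·-congʳ κ (transpose-cong κa≡a κb≡b) ⟨
        transpose (κ ⟨$⟩ʳ a) (κ ⟨$⟩ʳ b) · κ    ≈⟨ transpose-conjugate κ a b ⟨
        κ · transpose a b                      ≈⟨ ·-congˡ κ τ≃ab ⟨
        κ · τ                                  ∎

      κ-moves-a⇒braid : κ ⟨$⟩ʳ a ≢ a → τ · κ · τ ≃ κ · τ · κ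
      κ-moves-a⇒braid κa≢a = begin
        τ · κ · τ                              ≈⟨ ·-congʳ τ (·-congˡ τ κ≃ac) ⟩
        τ · transpose a c · τ                  ≈⟨ transposition-conjugate tτ a c ⟩
        transpose (τ ⟨$⟩ʳ a) (τ ⟨$⟩ʳ c)        ≈⟨ transpose-cong τa≡b τc≡c ⟩
        transpose b c                          ≈⟨ transpose-comm b c ⟩
        transpose c b                          ≈⟨ transpose-cong refl κb≡b ⟨
        transpose (κ ⟨$⟩ʳ a) (κ ⟨$⟩ʳ b)        ≈⟨ transposition-conjugate tκ a b ⟨
        κ · transpose a b · κ                  ≈⟨ ·-congʳ κ (·-congˡ κ τ≃ab) ⟨
        κ · τ · κ                              ∎
        where
          c = κ ⟨$⟩ʳ a
          c≢b : c ≢ b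
          c≢b c≡b = a≢b (⟨$⟩ʳ-injective κ (trans c≡b (sym κb≡b)))
          κ≃ac : κ ≃ transpose a c
          κ≃ac = transposition-determined tκ refl (κa≢a ∘ sym)
          τa≡b : τ ⟨$⟩ʳ a ≡ b
          τa≡b = trans (≃⇒≈ τ≃ab a) (transpose-applyˡ a b)
          τc≡c : τ ⟨$⟩ʳ c ≡ c
          τc≡c = trans (≃⇒≈ τ≃ab c) (transpose-apply-other κa≢a c≢b)

  square-parallel-sides : {τ κ α β : Sym n} →
    Transposition τ → Transposition κ → Transposition α → Transposition β →
    ¬ κ ≃ τ → ¬ α ≃ τ → α · τ ≃ β · κ → α ≃ κ ⊎ β ≃ τ
  square-parallel-sides {τ} {κ} {α} {β} tτ tκ tα tβ κ≄τ α≄τ ατ≃βκ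
    with ≃-or-fixesEndpoint tτ tκ
  ... | inj₁ κ≃τ = ⊥-elim (κ≄τ κ≃τ)
  ... | inj₂ (fixesEndpoint a b a≢b τ≃ab κb≡b) =
    Sum.[ inj₂ ∘ α-fixes-a⇒β≃τ , inj₁ ∘ α-moves-a⇒α≃κ ] (toSum (α ⟨$⟩ʳ a ≟ a))
    where
      open ≡-Reasoning

      βb≡αa : β ⟨$⟩ʳ b ≡ α ⟨$⟩ʳ a
      βb≡αa = begin
        β ⟨$⟩ʳ b                ≡⟨ cong (β ⟨$⟩ʳ_) κb≡b ⟨
        β ⟨$⟩ʳ (κ ⟨$⟩ʳ b)       ≡⟨ ≃⇒≈ ατ≃βκ b ⟨
        α ⟨$⟩ʳ (τ ⟨$⟩ʳ b)       ≡⟨ cong (α ⟨$⟩ʳ_) (trans (≃⇒≈ τ≃ab b) (transpose-applyʳ a b)) ⟩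
        α ⟨$⟩ʳ a                ∎

      α-fixes-a⇒β≃τ : α ⟨$⟩ʳ a ≡ a → β ≃ τ
      α-fixes-a⇒β≃τ αa≡a =
        ≃-trans (transposition-determined tβ (trans βb≡αa αa≡a) (a≢b ∘ sym))
                (≃-trans (transpose-comm b a) (≃-sym τ≃ab))

      α-moves-a⇒α≃κ : α ⟨$⟩ʳ a ≢ a → α ≃ κ
      α-moves-a⇒α≃κ αa≢a = ≃-trans α≃au (≃-trans (transpose-comm a u) (≃-sym κ≃ua))
        where
          u = α ⟨$⟩ʳ a
          α≃au : α ≃ transpose a u
          α≃au = transposition-determined tα refl (αa≢a ∘ sym)
          u≢b : u ≢ b
          u≢b u≡b = α≄τ (≃-trans α≃au (≃-trans (transpose-cong refl u≡b) (≃-sym τ≃ab)))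
          β≃bu : β ≃ transpose b u
          β≃bu = transposition-determined tβ βb≡αa (u≢b ∘ sym)
          κu≡a : κ ⟨$⟩ʳ u ≡ a
          κu≡a = begin
            κ ⟨$⟩ʳ u                      ≡⟨ ≃⇒≈ (transposition-involutive tβ) (κ ⟨$⟩ʳ u) ⟨
            β ⟨$⟩ʳ (β ⟨$⟩ʳ (κ ⟨$⟩ʳ u))    ≡⟨ cong (β ⟨$⟩ʳ_) (≃⇒≈ ατ≃βκ u) ⟨
            β ⟨$⟩ʳ (α ⟨$⟩ʳ (τ ⟨$⟩ʳ u))    ≡⟨ cong (λ x → β ⟨$⟩ʳ (α ⟨$⟩ʳ x))
                                               (trans (≃⇒≈ τ≃ab u) (transpose-apply-other αa≢a u≢b)) ⟩
            β ⟨$⟩ʳ (α ⟨$⟩ʳ u)             ≡⟨ cong (β ⟨$⟩ʳ_) (trans (≃⇒≈ α≃au u) (transpose-applyʳ a u)) ⟩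
            β ⟨$⟩ʳ a                      ≡⟨ trans (≃⇒≈ β≃bu a) (transpose-apply-other a≢b (αa≢a ∘ sym)) ⟩
            a                             ∎
          κ≃ua : κ ≃ transpose u a
          κ≃ua = transposition-determined tκ κu≡a αa≢a

⊎-rotate : {A B C D : Set} → A ⊎ (B ⊎ (C ⊎ D)) → B ⊎ (C ⊎ (D ⊎ A))
⊎-rotate (inj₁ a) = inj₂ (inj₂ (inj₂ a))
⊎-rotate (inj₂ (inj₁ b)) = inj₁ b
⊎-rotate (inj₂ (inj₂ (inj₁ c))) = inj₂ (inj₁ c)
⊎-rotate (inj₂ (inj₂ (inj₂ d))) = inj₂ (inj₂ (inj₁ d))

⊎-rotate⁻¹ : {A B C D : Set} → B ⊎ (C ⊎ (D ⊎ A)) → A ⊎ (B ⊎ (C ⊎ D))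
⊎-rotate⁻¹ (inj₁ b) = inj₂ (inj₁ b)
⊎-rotate⁻¹ (inj₂ (inj₁ c)) = inj₂ (inj₂ (inj₁ c))
⊎-rotate⁻¹ (inj₂ (inj₂ (inj₁ d))) = inj₂ (inj₂ (inj₂ d))
⊎-rotate⁻¹ (inj₂ (inj₂ (inj₂ a))) = inj₁ a

⊎-reverse : {A B C D : Set} → A ⊎ (B ⊎ (C ⊎ D)) → D ⊎ (C ⊎ (B ⊎ A))
⊎-reverse (inj₁ a) = inj₂ (inj₂ (inj₂ a))
⊎-reverse (inj₂ (inj₁ b)) = inj₂ (inj₂ (inj₁ b))
⊎-reverse (inj₂ (inj₂ (inj₁ c))) = inj₂ (inj₁ c)
⊎-reverse (inj₂ (inj₂ (inj₂ d))) = inj₁ d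

module _ {n : ℕ} {S : List (Sym n)} where

  sameCycle-trans : (C D E : Cycle4 S) → SameCycle C D → SameCycle D E → SameCycle C E
  sameCycle-trans _ _ _ C~D D~E u v = D~E u v ⇔-∘ C~D u v

  sameCycle-sym : (C D : Cycle4 S) → SameCycle C D → SameCycle D C
  sameCycle-sym _ _ C~D u v = ⇔-sym (C~D u v)

  sameCycle-vertexwise : (C D : Cycle4 S) →
    v₀ C ≃ v₀ D → v₁ C ≃ v₁ D → v₂ C ≃ v₂ D → v₃ C ≃ v₃ D → SameCycle C D
  sameCycle-vertexwise C D p₀ p₁ p₂ p₃ u v = mk⇔
    (Sum.map (edge-resp p₀ p₁) (Sum.map (edge-resp p₁ p₂)
      (Sum.map (edge-resp p₂ p₃) (edge-resp p₃ p₀))))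
    (Sum.map (edge-resp (≃-sym p₀) (≃-sym p₁)) (Sum.map (edge-resp (≃-sym p₁) (≃-sym p₂))
      (Sum.map (edge-resp (≃-sym p₂) (≃-sym p₃)) (edge-resp (≃-sym p₃) (≃-sym p₀)))))
    where
      edge-resp : {a b a′ b′ : Sym n} → a ≃ a′ → b ≃ b′ →
        (u ≈ a × v ≈ b) ⊎ (u ≈ b × v ≈ a) → (u ≈ a′ × v ≈ b′) ⊎ (u ≈ b′ × v ≈ a′)
      edge-resp (≈⇒≃ a≈a′) (≈⇒≃ b≈b′) = Sum.map
        (λ (u≈a , v≈b) → (λ k → trans (u≈a k) (a≈a′ k)) , (λ k → trans (v≈b k) (b≈b′ k)))
        (λ (u≈b , v≈a) → (λ k → trans (u≈b k) (b≈b′ k)) , (λ k → trans (v≈a k) (a≈a′ k)))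

  rotate : Cycle4 S → Cycle4 S
  rotate C = record
    { v₀ = v₁ C ; v₁ = v₂ C ; v₂ = v₃ C ; v₃ = v₀ C
    ; d₀₁ = d₁₂ C ; d₀₂ = d₁₃ C ; d₀₃ = ≉-sym (v₀ C) (v₁ C) (d₀₁ C)
    ; d₁₂ = d₂₃ C ; d₁₃ = ≉-sym (v₀ C) (v₂ C) (d₀₂ C) ; d₂₃ = ≉-sym (v₀ C) (v₃ C) (d₀₃ C)
    ; a₀₁ = a₁₂ C ; a₁₂ = a₂₃ C ; a₂₃ = a₃₀ C ; a₃₀ = a₀₁ C
    }

  rotate-same : (C : Cycle4 S) → SameCycle C (rotate C)
  rotate-same C _ _ = mk⇔ ⊎-rotate ⊎-rotate⁻¹

  rotate^ : ℕ → Cycle4 S → Cycle4 S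
  rotate^ zero = id
  rotate^ (suc k) = rotate^ k ∘ rotate

  rotate^-same : (k : ℕ) (C : Cycle4 S) → SameCycle C (rotate^ k C)
  rotate^-same zero C _ _ = mk⇔ id id
  rotate^-same (suc k) C =
    sameCycle-trans C (rotate C) (rotate^ k (rotate C)) (rotate-same C) (rotate^-same k (rotate C))

  rotate^-onCycle : (k : ℕ) (C : Cycle4 S) (x : Sym n) → OnCycle x C → OnCycle x (rotate^ k C)
  rotate^-onCycle zero C x = id
  rotate^-onCycle (suc k) C x = rotate^-onCycle k (rotate C) x ∘ ⊎-rotate

  rotation-to-front : (C : Cycle4 S) (x : Sym n) → OnCycle x C → Σ[ k ∈ ℕ ] x ≈ v₀ (rotate^ k C)
  rotation-to-front C x (inj₁ x≈v₀) = 0 , x≈v₀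
  rotation-to-front C x (inj₂ (inj₁ x≈v₁)) = 1 , x≈v₁
  rotation-to-front C x (inj₂ (inj₂ (inj₁ x≈v₂))) = 2 , x≈v₂
  rotation-to-front C x (inj₂ (inj₂ (inj₂ x≈v₃))) = 3 , x≈v₃

  rotate-to-front : (C : Cycle4 S) (x y z : Sym n) → Contains3 C x y z →
    Σ[ D ∈ Cycle4 S ] SameCycle C D × x ≈ v₀ D × OnCycle y D × OnCycle z D
  rotate-to-front C x y z (x∈C , y∈C , z∈C) with rotation-to-front C x x∈C
  ... | k , x≈v₀ =
    rotate^ k C , rotate^-same k C , x≈v₀ , rotate^-onCycle k C y y∈C , rotate^-onCycle k C z z∈C

module CayleyGraph {n : ℕ} {S : List (Sym n)} (S-transp : All IsTransposition S) where

  ∈S⇒transposition : {σ : Sym n} → σ ∈S S → Transposition σ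
  ∈S⇒transposition = member S-transp
    where
      member : {σ : Sym n} {xs : List (Sym n)} → All IsTransposition xs → σ ∈S xs → Transposition σ
      member {xs = s ∷ _} (tₛ ∷ _) (here σ≈s) =
        transposition-resp (IsTransposition⇒Transposition {σ = s} tₛ) (≈⇒≃ λ k → sym (σ≈s k))
      member (_ ∷ tₛ) (there σ∈xs) = member tₛ σ∈xs

  ∈S-resp : {σ π : Sym n} → σ ≃ π → σ ∈S S → π ∈S S
  ∈S-resp (≈⇒≃ σ≈π) = Any.map λ σ≈s k → trans (sym (σ≈π k)) (σ≈s k)

  Adj-sym : (g h : Sym n) → Adj S g h → Adj S h g
  Adj-sym g h (s , s∈S , h≈sg) = s , s∈S , ≃⇒≈ (begin
    g          ≡⟨⟩
    e · g      ≈⟨ ·-congʳ g (transposition-involutive (∈S⇒transposition {σ = s} s∈S)) ⟨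
    s · s · g  ≈⟨ ·-congˡ s h≃sg ⟨
    s · h      ∎)
    where
      open ≃-Reasoning
      h≃sg : h ≃ s · g
      h≃sg = ≈⇒≃ h≈sg

  transpositions-not-adjacent : (g h : Sym n) → Transposition g → Transposition h → ¬ Adj S g h
  transpositions-not-adjacent g h tg th (s , s∈S , h≈sg) =
    transposition-product-not-transposition (∈S⇒transposition {σ = s} s∈S) tg
      (transposition-resp th (≈⇒≃ h≈sg))

  reflect : Cycle4 S → Cycle4 S
  reflect C = record
    { v₀ = v₀ C ; v₁ = v₃ C ; v₂ = v₂ C ; v₃ = v₁ C
    ; d₀₁ = d₀₃ C ; d₀₂ = d₀₂ C ; d₀₃ = d₀₁ C
    ; d₁₂ = ≉-sym (v₂ C) (v₃ C) (d₂₃ C) ; d₁₃ = ≉-sym (v₁ C) (v₃ C) (d₁₃ C)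
    ; d₂₃ = ≉-sym (v₁ C) (v₂ C) (d₁₂ C)
    ; a₀₁ = Adj-sym (v₃ C) (v₀ C) (a₃₀ C) ; a₁₂ = Adj-sym (v₂ C) (v₃ C) (a₂₃ C)
    ; a₂₃ = Adj-sym (v₁ C) (v₂ C) (a₁₂ C) ; a₃₀ = Adj-sym (v₀ C) (v₁ C) (a₀₁ C)
    }

  reflect-same : (C : Cycle4 S) → SameCycle C (reflect C)
  reflect-same C _ _ = mk⇔ reflect-edges reflect-edges
    where
      reflect-edges : {A B C D A′ B′ C′ D′ : Set} →
        (A ⊎ A′) ⊎ ((B ⊎ B′) ⊎ ((C ⊎ C′) ⊎ (D ⊎ D′))) →
        (D′ ⊎ D) ⊎ ((C′ ⊎ C) ⊎ ((B′ ⊎ B) ⊎ (A′ ⊎ A)))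
      reflect-edges = ⊎-reverse ∘ Sum.map swap (Sum.map swap (Sum.map swap swap))

  module Squares (τ κ : Sym n) (τ∈S : τ ∈S S) (κ∈S : κ ∈S S) (τ≄κ : ¬ τ ≃ κ) where

    tτ : Transposition τ
    tτ = ∈S⇒transposition τ∈S

    tκ : Transposition κ
    tκ = ∈S⇒transposition κ∈S

    record Square : Set where
      field
        α β : Sym n
        α∈S : α ∈S S
        β∈S : β ∈S S
        α≄τ : ¬ α ≃ τ
        closes : α · τ ≃ β · κ

    opposite : Square → Sym n
    opposite sq = Square.α sq · τ

    square-cycle : Square → Cycle4 S
    square-cycle sq = record
      { v₀ = e ; v₁ = τ ; v₂ = α · τ ; v₃ = κ
      ; d₀₁ = ≄⇒≉ (transposition-≄e tτ ∘ ≃-sym)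
      ; d₀₂ = ≄⇒≉ e≄ατ
      ; d₀₃ = ≄⇒≉ (transposition-≄e tκ ∘ ≃-sym)
      ; d₁₂ = ≄⇒≉ τ≄ατ
      ; d₁₃ = ≄⇒≉ τ≄κ
      ; d₂₃ = ≄⇒≉ ατ≄κ
      ; a₀₁ = τ , τ∈S , (λ _ → refl)
      ; a₁₂ = α , α∈S , (λ _ → refl)
      ; a₂₃ = β , β∈S , ≃⇒≈ κ≃βατ
      ; a₃₀ = κ , κ∈S , ≃⇒≈ e≃κκ
      }
      where
        open Square sq
        open ≃-Reasoning
        tα : Transposition α
        tα = ∈S⇒transposition α∈S
        tβ : Transposition β
        tβ = ∈S⇒transposition β∈S
        e≄ατ : ¬ e ≃ α · τ
        e≄ατ e≃ατ = α≄τ (·-cancelʳ tτ (begin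
          α · τ  ≈⟨ e≃ατ ⟨
          e      ≈⟨ transposition-involutive tτ ⟨
          τ · τ  ∎))
        τ≄ατ : ¬ τ ≃ α · τ
        τ≄ατ τ≃ατ = transposition-≄e tα (≃-sym (·-cancelʳ tτ τ≃ατ))
        ατ≄κ : ¬ α · τ ≃ κ
        ατ≄κ ατ≃κ = transposition-≄e tβ (·-cancelʳ tκ (≃-trans (≃-sym closes) ατ≃κ))
        κ≃βατ : κ ≃ β · (α · τ)
        κ≃βατ = begin
          κ            ≡⟨⟩
          e · κ        ≈⟨ ·-congʳ κ (transposition-involutive tβ) ⟨
          β · β · κ    ≈⟨ ·-congˡ β closes ⟨
          β · (α · τ)  ∎
        e≃κκ : e ≃ κ · κ
        e≃κκ = ≃-sym (transposition-involutive tκ)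

    square-contains : (sq : Square) → Contains3 (square-cycle sq) e τ κ
    square-contains _ =
      inj₁ (λ _ → refl) , inj₂ (inj₁ (λ _ → refl)) , inj₂ (inj₂ (inj₂ (λ _ → refl)))

    square-cycle-cong : (sq sq′ : Square) → opposite sq ≃ opposite sq′ →
      SameCycle (square-cycle sq) (square-cycle sq′)
    square-cycle-cong sq sq′ w≃w′ =
      sameCycle-vertexwise (square-cycle sq) (square-cycle sq′) ≃-refl ≃-refl w≃w′ ≃-refl

    -- The opposite vertex is recovered as the neighbour of τ other than e.
    opposite-determined : (C : Cycle4 S) (sq sq′ : Square) →
      SameCycle C (square-cycle sq) → SameCycle C (square-cycle sq′) → opposite sq ≃ opposite sq′
    opposite-determined C sq sq′ C~D C~D′ =
      ≈⇒≃ (τw-edge⇒w≈w′ (Equivalence.to (C~D′ τ w) (Equivalence.from (C~D τ w) τw-edge)))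
      where
        w = opposite sq
        w′ = opposite sq′
        D = square-cycle sq
        D′ = square-cycle sq′
        τw-edge : IsEdgeOf D τ w
        τw-edge = inj₂ (inj₁ (inj₁ ((λ _ → refl) , (λ _ → refl))))
        τw-edge⇒w≈w′ : IsEdgeOf D′ τ w → w ≈ w′
        τw-edge⇒w≈w′ (inj₁ (inj₁ (τ≈e , _))) = ⊥-elim (≉-sym e τ (d₀₁ D′) τ≈e)
        τw-edge⇒w≈w′ (inj₁ (inj₂ (_ , w≈e))) = ⊥-elim (≉-sym e w (d₀₂ D) w≈e)
        τw-edge⇒w≈w′ (inj₂ (inj₁ (inj₁ (_ , w≈w′)))) = w≈w′
        τw-edge⇒w≈w′ (inj₂ (inj₁ (inj₂ (_ , w≈τ)))) = ⊥-elim (≉-sym τ w (d₁₂ D) w≈τ)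
        τw-edge⇒w≈w′ (inj₂ (inj₂ (inj₁ (inj₁ (τ≈w′ , _))))) = ⊥-elim (d₁₂ D′ τ≈w′)
        τw-edge⇒w≈w′ (inj₂ (inj₂ (inj₁ (inj₂ (τ≈κ , _))))) = ⊥-elim (d₁₃ D′ τ≈κ)
        τw-edge⇒w≈w′ (inj₂ (inj₂ (inj₂ (inj₁ (τ≈κ , _))))) = ⊥-elim (d₁₃ D′ τ≈κ)
        τw-edge⇒w≈w′ (inj₂ (inj₂ (inj₂ (inj₂ (τ≈e , _))))) = ⊥-elim (≉-sym e τ (d₀₁ D′) τ≈e)

    standard⇒square : (D : Cycle4 S) → e ≈ v₀ D → τ ≈ v₁ D → κ ≈ v₃ D →
      Σ[ sq ∈ Square ] SameCycle D (square-cycle sq)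
    standard⇒square D e≈v₀ τ≈v₁ κ≈v₃ with a₁₂ D | a₂₃ D
    ... | α , α∈S , v₂≈αv₁ | β , β∈S , v₃≈βv₂ =
      sq , sameCycle-vertexwise D (square-cycle sq) (≃-sym e≃v₀) (≃-sym τ≃v₁) v₂≃ατ (≃-sym κ≃v₃)
      where
        open ≃-Reasoning
        e≃v₀ : e ≃ v₀ D
        e≃v₀ = ≈⇒≃ e≈v₀
        τ≃v₁ : τ ≃ v₁ D
        τ≃v₁ = ≈⇒≃ τ≈v₁
        κ≃v₃ : κ ≃ v₃ D
        κ≃v₃ = ≈⇒≃ κ≈v₃
        v₂≃αv₁ : v₂ D ≃ α · v₁ D
        v₂≃αv₁ = ≈⇒≃ v₂≈αv₁
        v₂≃ατ : v₂ D ≃ α · τ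
        v₂≃ατ = ≃-trans v₂≃αv₁ (·-congˡ α (≃-sym τ≃v₁))
        v₃≃βv₂ : v₃ D ≃ β · v₂ D
        v₃≃βv₂ = ≈⇒≃ v₃≈βv₂
        tβ : Transposition β
        tβ = ∈S⇒transposition β∈S
        closes : α · τ ≃ β · κ
        closes = begin
          α · τ          ≈⟨ v₂≃ατ ⟨
          v₂ D           ≡⟨⟩
          e · v₂ D       ≈⟨ ·-congʳ (v₂ D) (transposition-involutive tβ) ⟨
          β · β · v₂ D   ≈⟨ ·-congˡ β v₃≃βv₂ ⟨
          β · v₃ D       ≈⟨ ·-congˡ β κ≃v₃ ⟨
          β · κ          ∎
        v₀≄v₂ : ¬ v₀ D ≃ v₂ D
        v₀≄v₂ v₀≃v₂ = d₀₂ D (≃⇒≈ v₀≃v₂)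
        α≄τ : ¬ α ≃ τ
        α≄τ α≃τ = v₀≄v₂ (begin
          v₀ D   ≈⟨ e≃v₀ ⟨
          e      ≈⟨ transposition-involutive tτ ⟨
          τ · τ  ≈⟨ ·-congʳ τ α≃τ ⟨
          α · τ  ≈⟨ v₂≃ατ ⟨
          v₂ D   ∎)
        sq : Square
        sq = record { α = α ; β = β ; α∈S = α∈S ; β∈S = β∈S ; α≄τ = α≄τ ; closes = closes }

    transposition-at : {x : Sym n} (g : Sym n) → Transposition x → x ≈ g → Transposition g
    transposition-at g tx x≈g = transposition-resp tx (≈⇒≃ x≈g)

    τκ-apart : (g : Sym n) → τ ≈ g → ¬ κ ≈ g
    τκ-apart g τ≈g κ≈g = τ≄κ (≈⇒≃ λ k → trans (τ≈g k) (sym (κ≈g k)))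

    τκ-not-adjacent : (g h : Sym n) → (τ ≈ g × κ ≈ h) ⊎ (κ ≈ g × τ ≈ h) → ¬ Adj S g h
    τκ-not-adjacent g h (inj₁ (τ≈g , κ≈h)) =
      transpositions-not-adjacent g h (transposition-at g tτ τ≈g) (transposition-at h tκ κ≈h)
    τκ-not-adjacent g h (inj₂ (κ≈g , τ≈h)) =
      transpositions-not-adjacent g h (transposition-at g tκ κ≈g) (transposition-at h tτ τ≈h)

    front⇒square : (D : Cycle4 S) → e ≈ v₀ D → OnCycle τ D → OnCycle κ D →
      Σ[ sq ∈ Square ] SameCycle D (square-cycle sq)
    front⇒square D e≈v₀ = place
      where
        off-v₀ : {x : Sym n} → Transposition x → ¬ x ≈ v₀ D
        off-v₀ tx x≈v₀ = transposition-≄e (transposition-at (v₀ D) tx x≈v₀) (≈⇒≃ λ k → sym (e≈v₀ k))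

        reflected : Σ[ sq ∈ Square ] SameCycle (reflect D) (square-cycle sq) →
          Σ[ sq ∈ Square ] SameCycle D (square-cycle sq)
        reflected (sq , R~sq) =
          sq , sameCycle-trans D (reflect D) (square-cycle sq) (reflect-same D) R~sq

        place : OnCycle τ D → OnCycle κ D → Σ[ sq ∈ Square ] SameCycle D (square-cycle sq)
        place (inj₁ τ≈v₀) _ = ⊥-elim (off-v₀ tτ τ≈v₀)
        place _ (inj₁ κ≈v₀) = ⊥-elim (off-v₀ tκ κ≈v₀)
        place (inj₂ (inj₁ τ≈v₁)) (inj₂ (inj₂ (inj₂ κ≈v₃))) = standard⇒square D e≈v₀ τ≈v₁ κ≈v₃
        place (inj₂ (inj₂ (inj₂ τ≈v₃))) (inj₂ (inj₁ κ≈v₁)) =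
          reflected (standard⇒square (reflect D) e≈v₀ τ≈v₃ κ≈v₁)
        place (inj₂ (inj₁ τ≈v₁)) (inj₂ (inj₁ κ≈v₁)) = ⊥-elim (τκ-apart (v₁ D) τ≈v₁ κ≈v₁)
        place (inj₂ (inj₂ (inj₁ τ≈v₂))) (inj₂ (inj₂ (inj₁ κ≈v₂))) =
          ⊥-elim (τκ-apart (v₂ D) τ≈v₂ κ≈v₂)
        place (inj₂ (inj₂ (inj₂ τ≈v₃))) (inj₂ (inj₂ (inj₂ κ≈v₃))) =
          ⊥-elim (τκ-apart (v₃ D) τ≈v₃ κ≈v₃)
        place (inj₂ (inj₁ τ≈v₁)) (inj₂ (inj₂ (inj₁ κ≈v₂))) =
          ⊥-elim (τκ-not-adjacent (v₁ D) (v₂ D) (inj₁ (τ≈v₁ , κ≈v₂)) (a₁₂ D))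
        place (inj₂ (inj₂ (inj₁ τ≈v₂))) (inj₂ (inj₁ κ≈v₁)) =
          ⊥-elim (τκ-not-adjacent (v₁ D) (v₂ D) (inj₂ (κ≈v₁ , τ≈v₂)) (a₁₂ D))
        place (inj₂ (inj₂ (inj₁ τ≈v₂))) (inj₂ (inj₂ (inj₂ κ≈v₃))) =
          ⊥-elim (τκ-not-adjacent (v₂ D) (v₃ D) (inj₁ (τ≈v₂ , κ≈v₃)) (a₂₃ D))
        place (inj₂ (inj₂ (inj₂ τ≈v₃))) (inj₂ (inj₂ (inj₁ κ≈v₂))) =
          ⊥-elim (τκ-not-adjacent (v₂ D) (v₃ D) (inj₂ (κ≈v₂ , τ≈v₃)) (a₂₃ D))

    cycle⇒square : (C : Cycle4 S) → Contains3 C e τ κ →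
      Σ[ sq ∈ Square ] SameCycle C (square-cycle sq)
    cycle⇒square C C∋eτκ with rotate-to-front C e τ κ C∋eτκ
    ... | D , C~D , e≈v₀ , τ∈D , κ∈D with front⇒square D e≈v₀ τ∈D κ∈D
    ...   | sq , D~sq = sq , sameCycle-trans C D (square-cycle sq) C~D D~sq

    square-labels : (sq : Square) → let open Square sq in
      (α ≃ κ × β ≃ κ · τ · κ) ⊎ (β ≃ τ × α ≃ τ · κ · τ)
    square-labels sq = Sum.map (λ α≃κ → α≃κ , β≃κτκ α≃κ) (λ β≃τ → β≃τ , α≃τκτ β≃τ)
      (square-parallel-sides tτ tκ tα tβ (τ≄κ ∘ ≃-sym) α≄τ closes)
      where
        open Square sq
        open ≃-Reasoning
        tα : Transposition α
        tα = ∈S⇒transposition α∈S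
        tβ : Transposition β
        tβ = ∈S⇒transposition β∈S
        β≃κτκ : α ≃ κ → β ≃ κ · τ · κ
        β≃κτκ α≃κ = ·-cancelʳ tκ (begin
          β · κ          ≈⟨ closes ⟨
          α · τ          ≈⟨ ·-congʳ τ α≃κ ⟩
          κ · τ          ≈⟨ ·-congˡ (κ · τ) (transposition-involutive tκ) ⟨
          κ · τ · κ · κ  ∎)
        α≃τκτ : β ≃ τ → α ≃ τ · κ · τ
        α≃τκτ β≃τ = ·-cancelʳ tτ (begin
          α · τ          ≈⟨ closes ⟩
          β · κ          ≈⟨ ·-congʳ κ β≃τ ⟩
          τ · κ          ≈⟨ ·-congˡ (τ · κ) (transposition-involutive tτ) ⟨
          τ · κ · τ · τ  ∎)

    commuting⇒opposite : τ · κ ≃ κ · τ → (sq : Square) → opposite sq ≃ κ · τ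
    commuting⇒opposite τκ≃κτ sq with square-labels sq
    ... | inj₁ (α≃κ , _) = ·-congʳ τ α≃κ
    ... | inj₂ (_ , α≃τκτ) = begin
      α · τ          ≈⟨ ·-congʳ τ α≃τκτ ⟩
      τ · κ · τ · τ  ≈⟨ ·-congˡ (τ · κ) (transposition-involutive tτ) ⟩
      τ · κ          ≈⟨ τκ≃κτ ⟩
      κ · τ          ∎
      where
        open Square sq
        open ≃-Reasoning

    commuting⇒unique : τ · κ ≃ κ · τ → UniqueCycle4Through S e τ κ
    commuting⇒unique τκ≃κτ = square-cycle sq₀ , square-contains sq₀ , unique
      where
        sq₀ : Square
        sq₀ = record
          { α = κ ; β = τ ; α∈S = κ∈S ; β∈S = τ∈S ; α≄τ = τ≄κ ∘ ≃-sym ; closes = ≃-sym τκ≃κτ }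
        unique : (D : Cycle4 S) → Contains3 D e τ κ → SameCycle (square-cycle sq₀) D
        unique D D∋eτκ with cycle⇒square D D∋eτκ
        ... | sq , D~sq = sameCycle-trans (square-cycle sq₀) (square-cycle sq) D
          (square-cycle-cong sq₀ sq (≃-sym (commuting⇒opposite τκ≃κτ sq)))
          (sameCycle-sym D (square-cycle sq) D~sq)

    square⇒τκτ∈S : τ · κ · τ ≃ κ · τ · κ → Square → (τ · κ · τ) ∈S S
    square⇒τκτ∈S braid sq with square-labels sq
    ... | inj₁ (_ , β≃κτκ) = ∈S-resp (≃-trans β≃κτκ (≃-sym braid)) (Square.β∈S sq)
    ... | inj₂ (_ , α≃τκτ) = ∈S-resp α≃τκτ (Square.α∈S sq)

    square-κτ : τ · κ · τ ≃ κ · τ · κ → (τ · κ · τ) ∈S S → Square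
    square-κτ braid τκτ∈S = record
      { α = κ ; β = τ · κ · τ ; α∈S = κ∈S ; β∈S = τκτ∈S ; α≄τ = τ≄κ ∘ ≃-sym
      ; closes = begin
          κ · τ          ≈⟨ ·-congˡ (κ · τ) (transposition-involutive tκ) ⟨
          κ · τ · κ · κ  ≈⟨ ·-congʳ κ braid ⟨
          τ · κ · τ · κ  ∎
      }
      where open ≃-Reasoning

    square-τκ : (τ · κ · τ) ∈S S → Square
    square-τκ τκτ∈S = record
      { α = τ · κ · τ ; β = τ ; α∈S = τκτ∈S ; β∈S = τ∈S ; α≄τ = τκτ≄τ
      ; closes = ·-congˡ (τ · κ) (transposition-involutive tτ)
      }
      where
        open ≃-Reasoning
        τκτ≄τ : ¬ τ · κ · τ ≃ τ
        τκτ≄τ τκτ≃τ = τ≄κ (≃-sym (·-cancelˡ tτ (begin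
          τ · κ  ≈⟨ ·-cancelʳ tτ τκτ≃eτ ⟩
          e      ≈⟨ transposition-involutive tτ ⟨
          τ · τ  ∎)))
          where
            τκτ≃eτ : τ · κ · τ ≃ e · τ
            τκτ≃eτ = τκτ≃τ

    -- If τ and κ do not commute, one square through e, τ, κ puts τκτ = κτκ into S, and then
    -- κτ and τκ are both opposite to e in such squares.
    unique⇒commuting : UniqueCycle4Through S e τ κ → τ · κ ≃ κ · τ
    unique⇒commuting (C , C∋eτκ , unique) = Sum.[ id , braid⇒commute ] (commute-or-braid tτ tκ)
      where
        braid⇒commute : τ · κ · τ ≃ κ · τ · κ → τ · κ ≃ κ · τ
        braid⇒commute braid = begin
          τ · κ          ≈⟨ ·-congˡ (τ · κ) (transposition-involutive tτ) ⟨
          τ · κ · τ · τ  ≈⟨ opposite-determined C sq₁ sq₂ (on-C sq₁) (on-C sq₂) ⟨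
          κ · τ          ∎
          where
            open ≃-Reasoning
            τκτ∈S : (τ · κ · τ) ∈S S
            τκτ∈S = square⇒τκτ∈S braid (proj₁ (cycle⇒square C C∋eτκ))
            sq₁ : Square
            sq₁ = square-κτ braid τκτ∈S
            sq₂ : Square
            sq₂ = square-τκ τκτ∈S
            on-C : (sq : Square) → SameCycle C (square-cycle sq)
            on-C sq = unique (square-cycle sq) (square-contains sq)

mainTheorem2 : (n : ℕ) (S : List (Sym n)) →
    All IsTransposition S → Generates S →
    (τ κ : Sym n) → τ ∈S S → κ ∈S S → ¬ (τ ≈ κ) →
    ((τ · κ) ≈ (κ · τ)) ⇔ UniqueCycle4Through S e τ κ
mainTheorem2 n S S-transp _ τ κ τ∈S κ∈S τ≉κ =
  mk⇔ (commuting⇒unique ∘ ≈⇒≃) (≃⇒≈ ∘ unique⇒commuting)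
  where open CayleyGraph.Squares S-transp τ κ τ∈S κ∈S (τ≉κ ∘ ≃⇒≈)
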